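{- Let $\Delta$ be a labeled hypergraph on $[d]$ (with $n=4$) having only edges of Type $2$ and Type $3$ and satisfying, for all distinct $e_1,e_2\in\Delta$: (i) if $e_1,e_2\in\Delta_3$ and $|e_1\cap e_2|\ge3$ then $e_1\cap e_2\in\Delta_2$; (ii) if $e_1\in\Delta_3$, $e_2\in\Delta_2$, $|e_1\cap e_2|\ge2$ then $e_2\subseteq e_1$; (iii) if $e_1,e_2\in\Delta_2$ then $|e_1\cap e_2|\le1$; (iv) if $e_1,e_2\in\Delta_2$ and $|e_1\cap e_2|=1$ then $e_1\cup e_2\subseteq x$ for some $x\in\Delta_3$. Let $M_\Delta$ be the matroid on $[d]$ whose circuits are the inclusion-minimal sets among $\bigcup_{e\in\Delta_2}\binom{e}{3}\cup\bigcup_{e\in\Delta_3}\binom{e}{4}\cup\binom{[d]}{5}$. Then $M_\Delta$ is the unique maximal element, in the weak order, of the set $\{N : N\preceq\Delta,\ \mathrm{rank}(N)\le4\}$ of matroids on $[d]$.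
   Context: A labeled hypergraph $\Delta$ on $[d]$ (with respect to $n=4$) is a collection of subsets (edges) each labeled with a Type $i\in\{0,1,2,3\}$, such that no two edges of the same type are properly contained in one another and each edge of Type $i$ has at least $i+1$ elements; $\Delta_i$ is the set of edges of Type $i$. $N\preceq\Delta$ means $\mathrm{rank}_N(e)\le i$ for every $e\in\Delta_i$. Weak order: $N_2\le N_1$ iff every dependent set of $N_1$ is dependent in $N_2$. (That the stated collection is the circuit set of a matroid is part of the setup.) -}

module Defs where

open import Data.Nat using (ℕ; _≤_; _<_; suc)
open import Data.Fin using (Fin)
open import Data.Fin.Subset using (Subset; ⊥; ⁅_⁆; _∈_; _∉_; _⊆_; _⊂_; _∩_; _∪_; ∣_∣)
open import Data.Product using (Σ; ∃; _×_; _,_)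
open import Data.Sum using (_⊎_)
open import Relation.Nullary using (¬_)
open import Relation.Binary.PropositionalEquality using (_≡_; _≢_)
open import Level using (Level; suc; _⊔_) renaming (zero to lzero)

record Matroid (d : ℕ) : Set₁ where
  field
    Indep       : Subset d → Set
    indep-empty : Indep ⊥
    indep-down  : ∀ {I J} → J ⊆ I → Indep I → Indep J
    exchange    : ∀ {I J} → Indep I → Indep J → ∣ I ∣ < ∣ J ∣ →
                  ∃ λ x → x ∈ J × x ∉ I × Indep (I ∪ ⁅ x ⁆)
open Matroid public

module _ {d : ℕ} where

  Dependent : Matroid d → Subset d → Set
  Dependent M S = ¬ Indep M S

  RankLe : Matroid d → Subset d → ℕ → Set
  RankLe M S k = ∀ I → I ⊆ S → Indep M I → ∣ I ∣ ≤ k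

  MatroidRankLe : Matroid d → ℕ → Set
  MatroidRankLe M k = ∀ I → Indep M I → ∣ I ∣ ≤ k

  Circuit : Matroid d → Subset d → Set
  Circuit M C = Dependent M C × (∀ T → T ⊂ C → Indep M T)

  _≤w_ : Matroid d → Matroid d → Set
  N₂ ≤w N₁ = ∀ S → Dependent N₁ S → Dependent N₂ S

record LabeledHypergraph23 (d : ℕ) : Set₁ where
  field
    Δ₂ : Subset d → Set
    Δ₃ : Subset d → Set
    antichain₂ : ∀ e f → Δ₂ e → Δ₂ f → ¬ (e ⊂ f)
    antichain₃ : ∀ e f → Δ₃ e → Δ₃ f → ¬ (e ⊂ f)
    size₂ : ∀ e → Δ₂ e → 3 ≤ ∣ e ∣
    size₃ : ∀ e → Δ₃ e → 4 ≤ ∣ e ∣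
open LabeledHypergraph23 public

module _ {d : ℕ} where

  _⪯_ : Matroid d → LabeledHypergraph23 d → Set
  N ⪯ Δ = (∀ e → Δ₂ Δ e → RankLe N e 2) × (∀ e → Δ₃ Δ e → RankLe N e 3)

  Cond-i : LabeledHypergraph23 d → Set
  Cond-i Δ = ∀ e₁ e₂ → Δ₃ Δ e₁ → Δ₃ Δ e₂ → e₁ ≢ e₂ → 3 ≤ ∣ e₁ ∩ e₂ ∣ → Δ₂ Δ (e₁ ∩ e₂)

  Cond-ii : LabeledHypergraph23 d → Set
  Cond-ii Δ = ∀ e₁ e₂ → Δ₃ Δ e₁ → Δ₂ Δ e₂ → 2 ≤ ∣ e₁ ∩ e₂ ∣ → e₂ ⊆ e₁

  Cond-iii : LabeledHypergraph23 d → Set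
  Cond-iii Δ = ∀ e₁ e₂ → Δ₂ Δ e₁ → Δ₂ Δ e₂ → e₁ ≢ e₂ → ∣ e₁ ∩ e₂ ∣ ≤ 1

  Cond-iv : LabeledHypergraph23 d → Set
  Cond-iv Δ = ∀ e₁ e₂ → Δ₂ Δ e₁ → Δ₂ Δ e₂ → e₁ ≢ e₂ → ∣ e₁ ∩ e₂ ∣ ≡ 1 →
              ∃ λ x → Δ₃ Δ x × (e₁ ∪ e₂) ⊆ x

  InFamily : LabeledHypergraph23 d → Subset d → Set
  InFamily Δ S =
      (∃ λ e → Δ₂ Δ e × S ⊆ e × ∣ S ∣ ≡ 3)
    ⊎ (∃ λ e → Δ₃ Δ e × S ⊆ e × ∣ S ∣ ≡ 4)
    ⊎ (∣ S ∣ ≡ 5)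

  MinimalInFamily : LabeledHypergraph23 d → Subset d → Set
  MinimalInFamily Δ S = InFamily Δ S × (∀ T → T ⊂ S → ¬ InFamily Δ T)

  IsMΔ : LabeledHypergraph23 d → Matroid d → Set
  IsMΔ Δ M = ∀ C → (Circuit M C → MinimalInFamily Δ C) × (MinimalInFamily Δ C → Circuit M C)

  InSet : LabeledHypergraph23 d → Matroid d → Set
  InSet Δ N = N ⪯ Δ × MatroidRankLe N 4

-- Membership of N in the set says precisely that every member of the family is N-dependent:
-- a 3-subset of a Type 2 edge, a 4-subset of a Type 3 edge or any 5-set exceeds the
-- permitted rank. M_Δ has this property, since each member of the family contains a
-- minimal one, i.e. a circuit of M_Δ. Conversely, if N has it, every circuit of M_Δ is
-- N-dependent, and as every M_Δ-dependent set contains a circuit, N ≤ M_Δ. Both arguments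
-- are classical, but their conclusions are negations, so they hold in double-negation form.
module Submission where

open import Defs
open import Data.Nat using (ℕ; zero; suc; _≤_; _≤?_; z≤n; s≤s)
open import Data.Nat.Properties using (≰⇒>; 1+n≰n)
open import Data.Fin.Subset using (Subset; inside; outside; _⊆_; _⊂_; ∣_∣)
open import Data.Fin.Subset.Properties using (⊆-refl; ⊆-trans; ⊆⊤; out⊆; s⊆s)
open import Data.Fin.Subset.Induction using (Acc; acc; ⊂-wellFounded)
open import Data.Vec using ([]; _∷_)
open import Data.Product using (_×_; ∃; _,_; proj₁; proj₂)
open import Data.Sum using (inj₁; inj₂)
open import Function.Bundles using (_⇔_; mk⇔; Equivalence)
open import Relation.Nullary using (¬_; yes; no; contradiction)
open import Relation.Nullary.Decidable using (¬¬-excluded-middle)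
open import Relation.Binary.PropositionalEquality using (_≡_; refl; cong; subst)

open Equivalence using (to; from)

private
  variable
    n k : ℕ

¬¬-pull-→ : {A B : Set} → (A → ¬ ¬ B) → ¬ ¬ (A → B)
¬¬-pull-→ f ¬[A→B] = ¬[A→B] λ a → contradiction (λ b → ¬[A→B] λ _ → b) (f a)

¬¬-pull-Subset : {P : Subset n → Set} → (∀ U → ¬ ¬ P U) → ¬ ¬ (∀ U → P U)
¬¬-pull-Subset {zero}  f ¬∀ = f [] λ P[] → ¬∀ λ { [] → P[] }
¬¬-pull-Subset {suc n} f ¬∀ =
  ¬¬-pull-Subset (λ U → f (inside ∷ U))  λ ∀inside →
  ¬¬-pull-Subset (λ U → f (outside ∷ U)) λ ∀outside →
  ¬∀ λ { (inside ∷ U) → ∀inside U ; (outside ∷ U) → ∀outside U }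

subset-of-size : (X : Subset n) → k ≤ ∣ X ∣ → ∃ λ S → S ⊆ X × ∣ S ∣ ≡ k
subset-of-size {k = zero}  []            _         = [] , ⊆-refl , refl
subset-of-size             (outside ∷ X) k≤∣X∣     with subset-of-size X k≤∣X∣
... | S , S⊆X , ∣S∣≡k = outside ∷ S , out⊆ S⊆X , ∣S∣≡k
subset-of-size {k = zero}  (inside ∷ X)  _         with subset-of-size X z≤n
... | S , S⊆X , ∣S∣≡0 = outside ∷ S , out⊆ S⊆X , ∣S∣≡0
subset-of-size {k = suc k} (inside ∷ X)  (s≤s k≤∣X∣) with subset-of-size X k≤∣X∣
... | S , S⊆X , ∣S∣≡k = inside ∷ S , s⊆s S⊆X , cong suc ∣S∣≡k

Minimal : (Subset n → Set) → Subset n → Set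
Minimal P S = P S × (∀ T → T ⊂ S → ¬ P T)

¬¬-minimal-⊆ : {P : Subset n → Set} {S : Subset n} → P S → ¬ ¬ (∃ λ T → T ⊆ S × Minimal P T)
¬¬-minimal-⊆ {P = P} {S} = go S (⊂-wellFounded S)
  where
  go : ∀ S → Acc _⊂_ S → P S → ¬ ¬ (∃ λ T → T ⊆ S × Minimal P T)
  go S (acc smaller) PS ¬min = ¬¬-excluded-middle {A = ∃ λ U → U ⊂ S × P U} λ where
    (yes (U , U⊂S , PU)) →
      go U (smaller U⊂S) PU λ (T , T⊆U , minT) → ¬min (T , ⊆-trans T⊆U (proj₁ U⊂S) , minT)
    (no ¬below) → ¬min (S , ⊆-refl , PS , λ U U⊂S PU → ¬below (U , U⊂S , PU))

module _ {d : ℕ} where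

  rankLe⇔subsets-dependent : (M : Matroid d) {X : Subset d} →
    RankLe M X k ⇔ (∀ S → S ⊆ X → ∣ S ∣ ≡ suc k → Dependent M S)
  rankLe⇔subsets-dependent {k} M {X} = mk⇔ rank⇒dep dep⇒rank
    where
    rank⇒dep : RankLe M X k → ∀ S → S ⊆ X → ∣ S ∣ ≡ suc k → Dependent M S
    rank⇒dep rank S S⊆X ∣S∣≡1+k indS = 1+n≰n (subst (_≤ k) ∣S∣≡1+k (rank S S⊆X indS))
    dep⇒rank : (∀ S → S ⊆ X → ∣ S ∣ ≡ suc k → Dependent M S) → RankLe M X k
    dep⇒rank dep I I⊆X indI with ∣ I ∣ ≤? k
    ... | yes ∣I∣≤k = ∣I∣≤k
    ... | no ∣I∣≰k with subset-of-size I (≰⇒> ∣I∣≰k)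
    ...   | S , S⊆I , ∣S∣≡1+k =
      contradiction (indep-down M S⊆I indI) (dep S (⊆-trans S⊆I I⊆X) ∣S∣≡1+k)

  module _ (M : Matroid d) where

    minimal-dependent⇒dependent : {P : Subset d → Set} →
      (∀ C → Minimal P C → Dependent M C) → ∀ {S} → P S → Dependent M S
    minimal-dependent⇒dependent minDep PS indS =
      ¬¬-minimal-⊆ PS λ (C , C⊆S , minC) → minDep C minC (indep-down M C⊆S indS)

    dependent⇒¬¬circuit : ∀ {S} → Dependent M S → ¬ ¬ (∃ λ C → C ⊆ S × Circuit M C)
    dependent⇒¬¬circuit depS ¬circuit =
      ¬¬-minimal-⊆ depS λ (C , C⊆S , depC , minC) →
      ¬¬-pull-Subset (λ U → ¬¬-pull-→ (minC U)) λ indepBelow →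
      ¬circuit (C , C⊆S , depC , indepBelow)

    circuits-dependent⇒≤w : (N : Matroid d) → (∀ C → Circuit M C → Dependent N C) → N ≤w M
    circuits-dependent⇒≤w N circDep S depS indS =
      dependent⇒¬¬circuit depS λ (C , C⊆S , circC) → circDep C circC (indep-down N C⊆S indS)

  inSet⇔family-dependent : (Δ : LabeledHypergraph23 d) (N : Matroid d) →
    InSet Δ N ⇔ (∀ S → InFamily Δ S → Dependent N S)
  inSet⇔family-dependent Δ N = mk⇔ inSet⇒dep dep⇒inSet
    where
    inSet⇒dep : InSet Δ N → ∀ S → InFamily Δ S → Dependent N S
    inSet⇒dep ((rank₂ , _) , _) S (inj₁ (e , e∈Δ₂ , S⊆e , ∣S∣≡3)) =
      to (rankLe⇔subsets-dependent N) (rank₂ e e∈Δ₂) S S⊆e ∣S∣≡3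
    inSet⇒dep ((_ , rank₃) , _) S (inj₂ (inj₁ (e , e∈Δ₃ , S⊆e , ∣S∣≡4))) =
      to (rankLe⇔subsets-dependent N) (rank₃ e e∈Δ₃) S S⊆e ∣S∣≡4
    inSet⇒dep (_ , rank₄) S (inj₂ (inj₂ ∣S∣≡5)) =
      to (rankLe⇔subsets-dependent N) (λ I _ → rank₄ I) S ⊆⊤ ∣S∣≡5
    dep⇒inSet : (∀ S → InFamily Δ S → Dependent N S) → InSet Δ N
    dep⇒inSet dep = (rank₂ , rank₃) , rank₄
      where
      rank₂ : ∀ e → Δ₂ Δ e → RankLe N e 2
      rank₂ e e∈Δ₂ = from (rankLe⇔subsets-dependent N)
        λ S S⊆e ∣S∣≡3 → dep S (inj₁ (e , e∈Δ₂ , S⊆e , ∣S∣≡3))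
      rank₃ : ∀ e → Δ₃ Δ e → RankLe N e 3
      rank₃ e e∈Δ₃ = from (rankLe⇔subsets-dependent N)
        λ S S⊆e ∣S∣≡4 → dep S (inj₂ (inj₁ (e , e∈Δ₃ , S⊆e , ∣S∣≡4)))
      rank₄ : MatroidRankLe N 4
      rank₄ I = from (rankLe⇔subsets-dependent N)
        (λ S _ ∣S∣≡5 → dep S (inj₂ (inj₂ ∣S∣≡5))) I ⊆⊤

-- Conditions (i)–(iv) are what make the minimal members of the family the circuits of a
-- matroid.
lemma5p3 : (d : ℕ) (Δ : LabeledHypergraph23 d) →
    Cond-i Δ → Cond-ii Δ → Cond-iii Δ → Cond-iv Δ →
    (M : Matroid d) → IsMΔ Δ M →
    InSet Δ M × (∀ (N : Matroid d) → InSet Δ N → N ≤w M)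
lemma5p3 d Δ _ _ _ _ M isMΔ = M∈Set , M-maximum
  where
  M∈Set : InSet Δ M
  M∈Set = from (inSet⇔family-dependent Δ M) λ S →
    minimal-dependent⇒dependent M (λ C minC → proj₁ (proj₂ (isMΔ C) minC))

  M-maximum : ∀ N → InSet Δ N → N ≤w M
  M-maximum N N∈Set = circuits-dependent⇒≤w M N λ C circC →
    to (inSet⇔family-dependent Δ N) N∈Set C (proj₁ (proj₁ (isMΔ C) circC))
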